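{- Let $U$ be Friedman-reflexive with interpreter-selecting function ${\sf C}$, and let $A$ be a consistent finitely axiomatised theory with $U\not\rhd A$. Then $U+\neg{\sf C}(A)$ is consistent and not polyglot.
   Context: Theories are first-order theories in finite signature; interpretations may be multi-dimensional and piecewise; $W\rhd D$ means $W$ interprets $D$. A $U$-sentence $C$ is an interpreter of finitely axiomatised $A$ over $U$ iff for all $U$-sentences $B$: $(U+B)\rhd A$ iff $U+B\vdash C$; $U$ is Friedman-reflexive iff every finitely axiomatised $A$ has one, and ${\sf C}(A)$ denotes a chosen interpreter. $U$ is polyglot iff for every consistent finitely axiomatised $A$ there is a $U$-sentence $B$ with $(U+B)\rhd A$ and $U+B$ consistent. -}

module Defs where

open import Data.Nat using (ℕ; zero; suc; _+_)
open import Data.Fin using (Fin; zero; suc; _↑ˡ_; _↑ʳ_; splitAt)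
open import Data.List using (List; []; _∷_; map)
open import Data.List.Membership.Propositional using (_∈_)
open import Data.List.Relation.Unary.All using (All)
open import Data.Product using (Σ; _×_; _,_; proj₁; proj₂)
open import Data.Sum using (_⊎_; inj₁; inj₂)
open import Relation.Binary.PropositionalEquality using (_≡_)
open import Relation.Nullary using (¬_)

record Signature : Set where
  field
    nRel  : ℕ
    arity : Fin nRel → ℕ
open Signature public

data Formula (S : Signature) (n : ℕ) : Set where
  rel  : (r : Fin (nRel S)) → (Fin (arity S r) → Fin n) → Formula S n
  _≐_  : Fin n → Fin n → Formula S n
  ⊥'   : Formula S n
  _⇒_  : Formula S n → Formula S n → Formula S n
  ∀'   : Formula S (suc n) → Formula S n

infixr 5 _⇒_
infix 7 _≐_

Sentence : Signature → Set
Sentence S = Formula S 0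

¬' : ∀ {S n} → Formula S n → Formula S n
¬' φ = φ ⇒ ⊥'

⊤' : ∀ {S n} → Formula S n
⊤' = ⊥' ⇒ ⊥'

_∧'_ : ∀ {S n} → Formula S n → Formula S n → Formula S n
φ ∧' ψ = ¬' (φ ⇒ ¬' ψ)

lift : ∀ {n m} → (Fin n → Fin m) → Fin (suc n) → Fin (suc m)
lift ρ zero    = zero
lift ρ (suc i) = suc (ρ i)

rename : ∀ {S n m} → (Fin n → Fin m) → Formula S n → Formula S m
rename ρ (rel r xs) = rel r (λ a → ρ (xs a))
rename ρ (x ≐ y)    = ρ x ≐ ρ y
rename ρ ⊥'         = ⊥'
rename ρ (φ ⇒ ψ)    = rename ρ φ ⇒ rename ρ ψ
rename ρ (∀' φ)     = ∀' (rename (lift ρ) φ)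

wk : ∀ {S n} → Formula S n → Formula S (suc n)
wk = rename suc

inst : ∀ {n} → Fin n → Fin (suc n) → Fin n
inst x zero    = x
inst x (suc i) = i

-- Classical first-order natural deduction (nonempty domains)

data _⊢ᵈ_ {S : Signature} : ∀ {n} → List (Formula S n) → Formula S n → Set where
  ax       : ∀ {n} {Γ : List (Formula S n)} {φ} → φ ∈ Γ → Γ ⊢ᵈ φ
  ⇒I       : ∀ {n} {Γ : List (Formula S n)} {φ ψ} → (φ ∷ Γ) ⊢ᵈ ψ → Γ ⊢ᵈ (φ ⇒ ψ)
  ⇒E       : ∀ {n} {Γ : List (Formula S n)} {φ ψ} → Γ ⊢ᵈ (φ ⇒ ψ) → Γ ⊢ᵈ φ → Γ ⊢ᵈ ψ
  raa      : ∀ {n} {Γ : List (Formula S n)} {φ} → (¬' φ ∷ Γ) ⊢ᵈ ⊥' → Γ ⊢ᵈ φ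
  ∀I       : ∀ {n} {Γ : List (Formula S n)} {φ} → map wk Γ ⊢ᵈ φ → Γ ⊢ᵈ ∀' φ
  ∀E       : ∀ {n} {Γ : List (Formula S n)} {φ} → Γ ⊢ᵈ ∀' φ → (x : Fin n) →
             Γ ⊢ᵈ rename (inst x) φ
  ≐refl    : ∀ {n} {Γ : List (Formula S n)} (x : Fin n) → Γ ⊢ᵈ (x ≐ x)
  ≐subst   : ∀ {n} {Γ : List (Formula S n)} {x y : Fin n} (φ : Formula S (suc n)) →
             Γ ⊢ᵈ (x ≐ y) → Γ ⊢ᵈ rename (inst x) φ → Γ ⊢ᵈ rename (inst y) φ
  nonempty : ∀ {n} {Γ : List (Formula S n)} {φ} → map wk Γ ⊢ᵈ wk φ → Γ ⊢ᵈ φ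

record Theory : Set₁ where
  field
    sig : Signature
    Ax  : Sentence sig → Set
open Theory public

_⊢_ : (T : Theory) → Sentence (sig T) → Set
T ⊢ σ = Σ (List (Sentence (sig T))) λ Γ → All (Ax T) Γ × (Γ ⊢ᵈ σ)

Consistent : Theory → Set
Consistent T = ¬ (T ⊢ ⊥')

_⊕_ : (T : Theory) → Sentence (sig T) → Theory
T ⊕ B = record { sig = sig T ; Ax = λ σ → Ax T σ ⊎ σ ≡ B }

record FinTheory : Set where
  field
    fsig   : Signature
    axioms : List (Sentence fsig)
open FinTheory public

⌜_⌝ : FinTheory → Theory
⌜ A ⌝ = record { sig = fsig A ; Ax = λ σ → σ ∈ axioms A }

-- Multi-dimensional piecewise interpretations (without parameters)

-- number of target variables representing n source variables placed in pieces π
size : ∀ {p n} → (Fin p → ℕ) → (Fin n → Fin p) → ℕ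
size {n = zero}  d π = 0
size {n = suc n} d π = d (π zero) + size d (λ i → π (suc i))

coord : ∀ {p n} (d : Fin p → ℕ) (π : Fin n → Fin p) (i : Fin n) →
        Fin (d (π i)) → Fin (size d π)
coord d π zero    k = k ↑ˡ size d (λ i → π (suc i))
coord d π (suc i) k = d (π zero) ↑ʳ coord d (λ j → π (suc j)) i k

split : ∀ {p n} (d : Fin p → ℕ) (π : Fin n → Fin p) →
        Fin (size d π) → Σ (Fin n) (λ i → Fin (d (π i)))
split {n = suc n} d π v with splitAt (d (π zero)) v
... | inj₁ k  = zero , k
... | inj₂ v' = let s = split d (λ i → π (suc i)) v' in suc (proj₁ s) , proj₂ s

blockRen : ∀ {p n m} (d : Fin p → ℕ) (π : Fin n → Fin p) (f : Fin m → Fin n) →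
           Fin (size d (λ a → π (f a))) → Fin (size d π)
blockRen d π f v = coord d π (f (proj₁ s)) (proj₂ s)
  where s = split d (λ a → π (f a)) v

pair : ∀ {n} → Fin n → Fin n → Fin 2 → Fin n
pair x y zero       = x
pair x y (suc zero) = y

extend : ∀ {p n} → Fin p → (Fin n → Fin p) → Fin (suc n) → Fin p
extend j π zero    = j
extend j π (suc i) = π i

∀ⁿ : ∀ {S m} (k : ℕ) → Formula S (k + m) → Formula S m
∀ⁿ zero    φ = φ
∀ⁿ (suc k) φ = ∀ⁿ k (∀' φ)

⋀ : ∀ {S m} (p : ℕ) → (Fin p → Formula S m) → Formula S m
⋀ zero    f = ⊤'
⋀ (suc p) f = f zero ∧' ⋀ p (λ j → f (suc j))

record Interpretation (W D : Signature) : Set where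
  field
    pieces : ℕ
    dim    : Fin pieces → ℕ
    dom    : (j : Fin pieces) → Formula W (dim j)
    relT   : (r : Fin (nRel D)) (ρ : Fin (arity D r) → Fin pieces) → Formula W (size dim ρ)
    eqT    : (ρ : Fin 2 → Fin pieces) → Formula W (size dim ρ)

module _ {W D : Signature} (K : Interpretation W D) where
  open Interpretation K

  translate : ∀ {n} (π : Fin n → Fin pieces) → Formula D n → Formula W (size dim π)
  translate π (rel r xs) = rename (blockRen dim π xs) (relT r (λ a → π (xs a)))
  translate π (x ≐ y)    = rename (blockRen dim π (pair x y)) (eqT (λ a → π (pair x y a)))
  translate π ⊥'         = ⊥'
  translate π (φ ⇒ ψ)    = translate π φ ⇒ translate π ψ
  translate π (∀' φ)     = ⋀ pieces (λ j →
    ∀ⁿ (dim j) (rename (λ k → k ↑ˡ size dim π) (dom j) ⇒ translate (extend j π) φ))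

  translateS : Sentence D → Sentence W
  translateS σ = translate (λ ()) σ

_⊳_ : Theory → Theory → Set
W ⊳ D = Σ (Interpretation (sig W) (sig D)) λ K → ∀ σ → D ⊢ σ → W ⊢ translateS K σ

IsInterpreter : (U : Theory) → FinTheory → Sentence (sig U) → Set
IsInterpreter U A C = ∀ (B : Sentence (sig U)) →
  ((U ⊕ B) ⊳ ⌜ A ⌝ → (U ⊕ B) ⊢ C) × ((U ⊕ B) ⊢ C → (U ⊕ B) ⊳ ⌜ A ⌝)

Polyglot : Theory → Set
Polyglot U = ∀ (A : FinTheory) → Consistent ⌜ A ⌝ →
  Σ (Sentence (sig U)) λ B → ((U ⊕ B) ⊳ ⌜ A ⌝) × Consistent (U ⊕ B)

-- If U + ¬C were inconsistent, U would
-- prove C and hence interpret A. If U + ¬C were polyglot, some consistent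
-- U + ¬C + B would interpret A; rewritten as the one-sentence extension
-- U + (¬C ∧ B), to which the interpreter property applies, it proves C while
-- refuting it.
module Submission where

open import Defs
open import Data.Product using (Σ; _×_; _,_; proj₁; proj₂)
open import Data.Sum using (_⊎_; inj₁; inj₂)
open import Data.List using (List; []; _∷_; _++_)
open import Data.List.Relation.Unary.Any using (here; there)
open import Data.List.Relation.Unary.All using (All; []; _∷_)
open import Data.List.Relation.Unary.All.Properties using (++⁺)
open import Data.List.Relation.Binary.Subset.Propositional using (_⊆_)
open import Data.List.Relation.Binary.Subset.Propositional.Properties
  using (⊆-trans; map⁺; xs⊆x∷xs; ∷⁺ʳ; ∈-∷⁺ʳ; xs⊆xs++ys; xs⊆ys++xs)
open import Relation.Binary.PropositionalEquality using (_≡_; refl)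
open import Relation.Nullary using (¬_)

module _ {S : Signature} where

  weaken : ∀ {n} {Γ Δ : List (Formula S n)} {φ} → Γ ⊆ Δ → Γ ⊢ᵈ φ → Δ ⊢ᵈ φ
  weaken Γ⊆Δ (ax φ∈Γ)       = ax (Γ⊆Δ φ∈Γ)
  weaken Γ⊆Δ (⇒I d)         = ⇒I (weaken (∷⁺ʳ _ Γ⊆Δ) d)
  weaken Γ⊆Δ (⇒E d e)       = ⇒E (weaken Γ⊆Δ d) (weaken Γ⊆Δ e)
  weaken Γ⊆Δ (raa d)        = raa (weaken (∷⁺ʳ _ Γ⊆Δ) d)
  weaken Γ⊆Δ (∀I d)         = ∀I (weaken (map⁺ wk Γ⊆Δ) d)
  weaken Γ⊆Δ (∀E d x)       = ∀E (weaken Γ⊆Δ d) x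
  weaken Γ⊆Δ (≐refl x)      = ≐refl x
  weaken Γ⊆Δ (≐subst φ d e) = ≐subst φ (weaken Γ⊆Δ d) (weaken Γ⊆Δ e)
  weaken Γ⊆Δ (nonempty d)   = nonempty (weaken (map⁺ wk Γ⊆Δ) d)

  ∧I : ∀ {n} {Γ : List (Formula S n)} {φ ψ} → Γ ⊢ᵈ φ → Γ ⊢ᵈ ψ → Γ ⊢ᵈ (φ ∧' ψ)
  ∧I d e = ⇒I (⇒E (⇒E (ax (here refl)) (weaken there d)) (weaken there e))

  ∧E₁ : ∀ {n} {Γ : List (Formula S n)} {φ ψ} → Γ ⊢ᵈ (φ ∧' ψ) → Γ ⊢ᵈ φ
  ∧E₁ d = raa (⇒E (weaken there d) (⇒I (⇒I (⇒E (ax (there (there (here refl)))) (ax (there (here refl)))))))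

  ∧E₂ : ∀ {n} {Γ : List (Formula S n)} {φ ψ} → Γ ⊢ᵈ (φ ∧' ψ) → Γ ⊢ᵈ ψ
  ∧E₂ d = raa (⇒E (weaken there d) (⇒I (ax (there (here refl)))))

  Axioms : Set₁
  Axioms = Sentence S → Set

  -- By record η, ⟨ Ax T ⟩ is T and ⟨ Ax T +ₐ B ⟩ is T ⊕ B, so what follows
  -- applies verbatim to the theories of the statement.
  ⟨_⟩ : Axioms → Theory
  ⟨ P ⟩ = record { sig = S ; Ax = P }

  _+ₐ_ : Axioms → Sentence S → Axioms
  (P +ₐ B) σ = P σ ⊎ σ ≡ B

  infixl 5 _+ₐ_

  _⊑_ : Axioms → Axioms → Set
  P ⊑ Q = ∀ {σ} → P σ → ⟨ Q ⟩ ⊢ σ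

  axiom : ∀ {P : Axioms} {σ} → P σ → ⟨ P ⟩ ⊢ σ
  axiom p = _ , p ∷ [] , ax (here refl)

  ⊢-⇒E : ∀ {P : Axioms} {φ ψ} → ⟨ P ⟩ ⊢ (φ ⇒ ψ) → ⟨ P ⟩ ⊢ φ → ⟨ P ⟩ ⊢ ψ
  ⊢-⇒E (Γ , Γ⊆P , d) (Δ , Δ⊆P , e) =
    Γ ++ Δ , ++⁺ Γ⊆P Δ⊆P , ⇒E (weaken (xs⊆xs++ys Γ Δ) d) (weaken (xs⊆ys++xs Δ Γ) e)

  ⊢-lift : ∀ {P : Axioms} {φ ψ} → (∀ {Γ} → Γ ⊢ᵈ φ → Γ ⊢ᵈ ψ) → ⟨ P ⟩ ⊢ φ → ⟨ P ⟩ ⊢ ψ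
  ⊢-lift rule (Γ , Γ⊆P , d) = Γ , Γ⊆P , rule d

  ⊢-cut : ∀ {P : Axioms} {Γ φ} → Γ ⊢ᵈ φ → All (⟨ P ⟩ ⊢_) Γ → ⟨ P ⟩ ⊢ φ
  ⊢-cut d []       = [] , [] , d
  ⊢-cut d (p ∷ ps) = ⊢-⇒E (⊢-cut (⇒I d) ps) p

  ⊢-⊑ : ∀ {P Q : Axioms} {φ} → P ⊑ Q → ⟨ P ⟩ ⊢ φ → ⟨ Q ⟩ ⊢ φ
  ⊢-⊑ P⊑Q (Γ , Γ⊆P , d) = ⊢-cut d (allProvable Γ⊆P)
    where
      allProvable : ∀ {Δ} → All _ Δ → All (⟨ _ ⟩ ⊢_) Δ
      allProvable []       = []
      allProvable (p ∷ ps) = P⊑Q p ∷ allProvable ps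

  ⊳-⊑ : ∀ {P Q : Axioms} {D} → P ⊑ Q → ⟨ P ⟩ ⊳ D → ⟨ Q ⟩ ⊳ D
  ⊳-⊑ P⊑Q (K , sound) = K , λ σ D⊢σ → ⊢-⊑ P⊑Q (sound σ D⊢σ)

  ⊑-refl : ∀ {P : Axioms} → P ⊑ P
  ⊑-refl = axiom

  ⊑-+ₐ : ∀ {P Q : Axioms} {B} → P ⊑ Q → ⟨ Q ⟩ ⊢ B → (P +ₐ B) ⊑ Q
  ⊑-+ₐ P⊑Q Q⊢B (inj₁ p)    = P⊑Q p
  ⊑-+ₐ P⊑Q Q⊢B (inj₂ refl) = Q⊢B

  +ₐ-+ₐ⊑+ₐ-∧ : ∀ {P : Axioms} {φ ψ} → (P +ₐ φ +ₐ ψ) ⊑ (P +ₐ (φ ∧' ψ))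
  +ₐ-+ₐ⊑+ₐ-∧ = ⊑-+ₐ (⊑-+ₐ (λ p → axiom (inj₁ p)) (⊢-lift ∧E₁ (axiom (inj₂ refl))))
                     (⊢-lift ∧E₂ (axiom (inj₂ refl)))

  +ₐ-∧⊑+ₐ-+ₐ : ∀ {P : Axioms} {φ ψ} → (P +ₐ (φ ∧' ψ)) ⊑ (P +ₐ φ +ₐ ψ)
  +ₐ-∧⊑+ₐ-+ₐ {φ = φ} {ψ} = ⊑-+ₐ (λ p → axiom (inj₁ (inj₁ p))) both
    where
      both : ⟨ _ +ₐ φ +ₐ ψ ⟩ ⊢ (φ ∧' ψ)
      both = _ , inj₁ (inj₂ refl) ∷ inj₂ refl ∷ [] ,
             ∧I (ax (here refl)) (ax (there (here refl)))

  dischargeAxiom : ∀ {P : Axioms} {B Γ} → All (P +ₐ B) Γ →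
    Σ (List (Sentence S)) λ Δ → All P Δ × Γ ⊆ B ∷ Δ
  dischargeAxiom []                 = [] , [] , λ ()
  dischargeAxiom (inj₁ p ∷ ps) with dischargeAxiom ps
  ... | Δ , Δ⊆P , Γ⊆B∷Δ =
    _ ∷ Δ , p ∷ Δ⊆P , ∈-∷⁺ʳ (there (here refl)) (⊆-trans Γ⊆B∷Δ (∷⁺ʳ _ (xs⊆x∷xs Δ _)))
  dischargeAxiom (inj₂ refl ∷ ps) with dischargeAxiom ps
  ... | Δ , Δ⊆P , Γ⊆B∷Δ = Δ , Δ⊆P , ∈-∷⁺ʳ (here refl) Γ⊆B∷Δ

  deduction : ∀ {P : Axioms} {B φ} → ⟨ P +ₐ B ⟩ ⊢ φ → ⟨ P ⟩ ⊢ (B ⇒ φ)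
  deduction (Γ , Γ⊆P+B , d) with dischargeAxiom Γ⊆P+B
  ... | Δ , Δ⊆P , Γ⊆B∷Δ = Δ , Δ⊆P , ⇒I (weaken Γ⊆B∷Δ d)

  ⊢-by-contradiction : ∀ {P : Axioms} {φ} → ⟨ P +ₐ ¬' φ ⟩ ⊢ ⊥' → ⟨ P ⟩ ⊢ φ
  ⊢-by-contradiction P+¬φ⊢⊥ with deduction P+¬φ⊢⊥
  ... | Δ , Δ⊆P , d = Δ , Δ⊆P , raa (⇒E (weaken there d) (ax (here refl)))

module _ {U : Theory} {A : FinTheory} {C : Sentence (sig U)} (isC : IsInterpreter U A C) where

  interpreter-unprovable : ¬ (U ⊳ ⌜ A ⌝) → ¬ (U ⊢ C)
  interpreter-unprovable U⋫A U⊢C =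
    U⋫A (⊳-⊑ (⊑-+ₐ ⊑-refl U⊢C) (proj₂ (isC C) (axiom (inj₂ refl))))

  interpreter-refutation-inconsistent : ∀ {B} → (U ⊕ B) ⊢ ¬' C → (U ⊕ B) ⊳ ⌜ A ⌝ →
    (U ⊕ B) ⊢ ⊥'
  interpreter-refutation-inconsistent {B} U+B⊢¬C U+B⊳A =
    ⊢-⇒E U+B⊢¬C (proj₁ (isC B) U+B⊳A)

theorem4p2 : (U : Theory) (C : FinTheory → Sentence (sig U)) →
    (∀ A → IsInterpreter U A (C A)) →
    (A : FinTheory) → Consistent ⌜ A ⌝ → ¬ (U ⊳ ⌜ A ⌝) →
    Consistent (U ⊕ ¬' (C A)) × ¬ Polyglot (U ⊕ ¬' (C A))
theorem4p2 U C isC A consistentA U⋫A = consistent , notPolyglot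
  where
    consistent : Consistent (U ⊕ ¬' (C A))
    consistent inconsistent =
      interpreter-unprovable (isC A) U⋫A (⊢-by-contradiction inconsistent)

    notPolyglot : ¬ Polyglot (U ⊕ ¬' (C A))
    notPolyglot polyglot with polyglot A consistentA
    ... | B , U+¬C+B⊳A , consistentU+¬C+B =
      consistentU+¬C+B (⊢-⊑ +ₐ-∧⊑+ₐ-+ₐ
        (interpreter-refutation-inconsistent (isC A) (⊢-lift ∧E₁ (axiom (inj₂ refl)))
          (⊳-⊑ +ₐ-+ₐ⊑+ₐ-∧ U+¬C+B⊳A)))
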